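{- Let $v$ and $k$ be integers with $2\le k<v$, and let $D$ be a $k$-element subset of the cyclic group $\mathbb{Z}_v$ with periodic distance $d=d(D)$. Then \[ d\le \left\lfloor \frac{v^{2}}{4(v-1)}\right\rfloor . \]
   Context: For a $k$-subset $D$ of an additive group $G$ of order $v$ (with $2\le k<v$) and $g\in G\setminus\{0\}$, let $m_D(g)=|\{(x,y)\in D\times D : x-y=g\}|$ be the multiplicity of $g$ in the multiset of differences $\{x-y : x,y\in D\}$. The distinct values of $m_D(g)$ over $g\neq 0$ are the difference levels $\mu_1<\dots<\mu_s$ of $D$, and $\Lambda=\mu_s=\max_{g\neq 0}m_D(g)$ is the largest difference level. The periodic distance of $D$ is $d(D)=k-\Lambda$. -}

module Defs where

open import Data.Nat using (ℕ; zero; suc; _+_; _*_; _∸_; _⊔_; NonZero)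
open import Data.Nat.DivMod using (_%_)
open import Data.Fin using (Fin; toℕ)
open import Data.Fin.Subset using (Subset; _∈_)
open import Data.Fin.Subset.Properties using (_∈?_)
open import Data.List using (List; filter; length; map; foldr; cartesianProduct)
open import Data.List.Base using (allFin)
open import Data.Product using (_×_; _,_)
open import Relation.Nullary.Decidable using (_×-dec_; ¬?)
open import Data.Fin.Properties using (_≟_)
open import Relation.Binary.PropositionalEquality using (_≡_)
import Data.Nat.Properties as ℕP

subℤ : (v : ℕ) .{{_ : NonZero v}} → Fin v → Fin v → ℕ
subℤ v x y = (toℕ x + (v ∸ toℕ y)) % v

mult : (v : ℕ) .{{_ : NonZero v}} → Subset v → Fin v → ℕ
mult v D g = length (filter P? (cartesianProduct (allFin v) (allFin v)))
  where
  P? : (p : Fin v × Fin v) → _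
  P? (x , y) = (x ∈? D) ×-dec ((y ∈? D) ×-dec (subℤ v x y ℕP.≟ toℕ g))

nonzeroElems : (v : ℕ) → List (Fin v)
nonzeroElems v = filter (λ g → ¬? (toℕ g ℕP.≟ 0)) (allFin v)

Lambda : (v : ℕ) .{{_ : NonZero v}} → Subset v → ℕ
Lambda v D = foldr _⊔_ 0 (map (mult v D) (nonzeroElems v))

periodicDistance : (v : ℕ) .{{_ : NonZero v}} → Subset v → ℕ
periodicDistance v D = Data.Fin.Subset.∣ D ∣ ∸ Lambda v D

module Submission where

-- Every ordered pair (x , y) of distinct elements of D has a nonzero difference x − y, so
-- k (k − 1) ≤ Σ_{g ≠ 0} m_D(g) ≤ (v − 1) Λ.  With d = k − Λ this gives
-- d (v − 1) ≤ k v − k² ≤ v² / 4, the last step being 4 k v ≤ v² + 4 k².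

open import Defs
open import Data.Nat using (ℕ; _≤_; _<_; _*_; _∸_; NonZero)
open import Data.Nat.DivMod using (_/_)
open import Data.Fin.Subset using (Subset; ∣_∣)
open import Relation.Binary.PropositionalEquality using (_≡_)

open import Data.Nat using (suc; _+_; _⊔_; z≤n; s≤s)
open import Data.Nat.Properties
open import Data.Nat.DivMod using (_%_; m%n<n; m<n⇒m%n≡m; %-distribˡ-+; [m+n]%n≡m%n; m*n/n≡m; /-monoˡ-≤)
open import Data.Nat.ListAction using (sum)
open import Data.Nat.ListAction.Properties using (sum-++)
open import Data.Nat.Solver using (module +-*-Solver)
open +-*-Solver using (solve; _:=_; _:+_; _:*_; con)
open import Algebra.Properties.CommutativeSemigroup +-commutativeSemigroup using (interchange)
open import Data.Fin using (Fin; toℕ; fromℕ<)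
import Data.Fin as Fin
open import Data.Vec using ([]; _∷_)
open import Data.Fin.Properties using (toℕ-fromℕ<; toℕ-injective; toℕ<n) renaming (_≟_ to _≟ᶠ_)
open import Data.Fin.Subset using (inside; outside; _∈_)
open import Data.Fin.Subset.Properties using (_∈?_)
open import Data.List using (List; []; _∷_; filter; length; map; foldr; cartesianProduct; _++_; tabulate; allFin)
open import Data.List.Properties using (map-++; map-cong; map-∘; map-tabulate; length-tabulate; length-filter)
open import Data.List.Membership.Propositional using () renaming (_∈_ to _∈ˡ_)
open import Data.List.Membership.Propositional.Properties using (∈-filter⁺; ∈-allFin)
open import Data.List.Relation.Unary.Any using (here; there)
open import Data.List.Relation.Unary.All using (All; []; _∷_)
open import Data.List.Relation.Unary.AllPairs using ([]; _∷_)
open import Data.List.Relation.Unary.Unique.Propositional using (Unique)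
open import Data.List.Relation.Unary.Unique.Propositional.Properties using (allFin⁺)
open import Data.Product using (_×_; _,_)
open import Data.Sum using (inj₁; inj₂)
open import Relation.Nullary using (Dec; yes; no; does; ¬_)
open import Data.Bool using (if_then_else_)
open import Relation.Nullary.Decidable using (_×-dec_; ¬?)
open import Relation.Unary using (Decidable)
open import Relation.Binary.PropositionalEquality using (_≢_; refl; sym; trans; cong; cong₂; subst; subst₂; module ≡-Reasoning)
open import Data.Empty using (⊥-elim)
open import Function using (_∘_)

-- Defined through 'does' so that it computes on decisions built with 'Dec.map′', such as '_∈?_'.
indicator : ∀ {p} {P : Set p} → Dec P → ℕ
indicator P? = if does P? then 1 else 0

indicator-yes : ∀ {p} {P : Set p} → P → (P? : Dec P) → indicator P? ≡ 1
indicator-yes _ (yes _) = refl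
indicator-yes p (no ¬p) = ⊥-elim (¬p p)

indicator-no : ∀ {p} {P : Set p} → ¬ P → (P? : Dec P) → indicator P? ≡ 0
indicator-no ¬p (yes p) = ⊥-elim (¬p p)
indicator-no _  (no _)  = refl

indicator≤ : ∀ {p} {P : Set p} {n} (P? : Dec P) → (P → 1 ≤ n) → indicator P? ≤ n
indicator≤ (yes p) 1≤n = 1≤n p
indicator≤ (no _)  _   = z≤n

module _ {a} {A : Set a} where

  sum-map-mono-≤ : ∀ {f g : A → ℕ} → (∀ x → f x ≤ g x) → ∀ xs → sum (map f xs) ≤ sum (map g xs)
  sum-map-mono-≤ f≤g []       = z≤n
  sum-map-mono-≤ f≤g (x ∷ xs) = +-mono-≤ (f≤g x) (sum-map-mono-≤ f≤g xs)

  sum-map-cong : ∀ {f g : A → ℕ} → (∀ x → f x ≡ g x) → ∀ xs → sum (map f xs) ≡ sum (map g xs)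
  sum-map-cong f≡g xs = cong sum (map-cong f≡g xs)

  sum-map-+ : ∀ (f g : A → ℕ) xs → sum (map (λ x → f x + g x) xs) ≡ sum (map f xs) + sum (map g xs)
  sum-map-+ f g []       = refl
  sum-map-+ f g (x ∷ xs) = begin
    (f x + g x) + sum (map (λ x → f x + g x) xs) ≡⟨ cong (f x + g x +_) (sum-map-+ f g xs) ⟩
    (f x + g x) + (sum (map f xs) + sum (map g xs)) ≡⟨ interchange (f x) (g x) _ _ ⟩
    (f x + sum (map f xs)) + (g x + sum (map g xs)) ∎
    where open ≡-Reasoning

  sum-map-*ˡ : ∀ c (f : A → ℕ) xs → sum (map (λ x → c * f x) xs) ≡ c * sum (map f xs)
  sum-map-*ˡ c f []       = sym (*-zeroʳ c)
  sum-map-*ˡ c f (x ∷ xs) = trans (cong (c * f x +_) (sum-map-*ˡ c f xs)) (sym (*-distribˡ-+ c (f x) _))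

  ∈⇒≤sum-map : ∀ (f : A → ℕ) {x xs} → x ∈ˡ xs → f x ≤ sum (map f xs)
  ∈⇒≤sum-map f {xs = y ∷ xs} (here refl) = m≤m+n (f y) _
  ∈⇒≤sum-map f {xs = y ∷ xs} (there x∈xs) = ≤-trans (∈⇒≤sum-map f x∈xs) (m≤n+m _ (f y))

  sum-map≤length*max : ∀ (f : A → ℕ) xs → sum (map f xs) ≤ length xs * foldr _⊔_ 0 (map f xs)
  sum-map≤length*max f []       = z≤n
  sum-map≤length*max f (x ∷ xs) =
    +-mono-≤ (m≤m⊔n (f x) M) (≤-trans (sum-map≤length*max f xs) (*-monoʳ-≤ (length xs) (m≤n⊔m (f x) M)))
    where M = foldr _⊔_ 0 (map f xs)

  length-filter≡sum-indicator : ∀ {p} {P : A → Set p} (P? : Decidable P) xs →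
                                length (filter P? xs) ≡ sum (map (λ x → indicator (P? x)) xs)
  length-filter≡sum-indicator P? []       = refl
  length-filter≡sum-indicator P? (x ∷ xs) with P? x
  ... | yes _ = cong suc (length-filter≡sum-indicator P? xs)
  ... | no _  = length-filter≡sum-indicator P? xs

module _ {a b} {A : Set a} {B : Set b} where

  sum-map-*-sum-map : ∀ (f : A → ℕ) (g : B → ℕ) xs ys →
    sum (map f xs) * sum (map g ys) ≡ sum (map (λ x → sum (map (λ y → f x * g y) ys)) xs)
  sum-map-*-sum-map f g []       ys = refl
  sum-map-*-sum-map f g (x ∷ xs) ys =
    trans (*-distribʳ-+ (sum (map g ys)) (f x) _)
          (cong₂ _+_ (sym (sum-map-*ˡ (f x) g ys)) (sum-map-*-sum-map f g xs ys))

  sum-map-comm : ∀ (f : A → B → ℕ) xs ys →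
    sum (map (λ x → sum (map (f x) ys)) xs) ≡ sum (map (λ y → sum (map (λ x → f x y) xs)) ys)
  sum-map-comm f []       ys = sym (sum-map-zero ys)
    where
    sum-map-zero : ∀ ys → sum (map (λ (_ : B) → 0) ys) ≡ 0
    sum-map-zero []       = refl
    sum-map-zero (_ ∷ ys) = sum-map-zero ys
  sum-map-comm f (x ∷ xs) ys =
    trans (cong (sum (map (f x) ys) +_) (sum-map-comm f xs ys))
          (sym (sum-map-+ (f x) (λ y → sum (map (λ x → f x y) xs)) ys))

  sum-map-cartesianProduct : ∀ (f : A × B → ℕ) xs ys →
    sum (map f (cartesianProduct xs ys)) ≡ sum (map (λ x → sum (map (λ y → f (x , y)) ys)) xs)
  sum-map-cartesianProduct f []       ys = refl
  sum-map-cartesianProduct f (x ∷ xs) ys = begin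
    sum (map f (map (x ,_) ys ++ cartesianProduct xs ys))
      ≡⟨ cong sum (map-++ f (map (x ,_) ys) _) ⟩
    sum (map f (map (x ,_) ys) ++ map f (cartesianProduct xs ys))
      ≡⟨ sum-++ (map f (map (x ,_) ys)) _ ⟩
    sum (map f (map (x ,_) ys)) + sum (map f (cartesianProduct xs ys))
      ≡⟨ cong₂ _+_ (cong sum (sym (map-∘ ys))) (sum-map-cartesianProduct f xs ys) ⟩
    sum (map (λ y → f (x , y)) ys) + sum (map (λ x → sum (map (λ y → f (x , y)) ys)) xs) ∎
    where open ≡-Reasoning

Unique⇒sum-indicator-≡≤1 : ∀ {n} (x : Fin n) ys → Unique ys → sum (map (λ y → indicator (x ≟ᶠ y)) ys) ≤ 1
Unique⇒sum-indicator-≡≤1 x []       _            = z≤n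
Unique⇒sum-indicator-≡≤1 x (y ∷ ys) (y∉ys ∷ uys) with x ≟ᶠ y
... | no _     = Unique⇒sum-indicator-≡≤1 x ys uys
... | yes refl = ≤-reflexive (cong suc (absent ys y∉ys))
  where
  absent : ∀ ys → All (x ≢_) ys → sum (map (λ y → indicator (x ≟ᶠ y)) ys) ≡ 0
  absent []       []           = refl
  absent (z ∷ ys) (x≢z ∷ x∉ys) = cong₂ _+_ (indicator-no x≢z (x ≟ᶠ z)) (absent ys x∉ys)

sum-indicator-∈∷ : ∀ {n} s (p : Subset n) → sum (map (λ x → indicator (x ∈? p)) (allFin n))
                   ≡ sum (map (λ x → indicator (x ∈? (s ∷ p))) (tabulate Fin.suc))
sum-indicator-∈∷ s p = cong sum (trans (map-tabulate (λ x → x) (λ x → indicator (x ∈? p)))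
                                       (sym (map-tabulate Fin.suc (λ x → indicator (x ∈? (s ∷ p))))))

∣p∣≡sum-indicator : ∀ {n} (p : Subset n) → ∣ p ∣ ≡ sum (map (λ x → indicator (x ∈? p)) (allFin n))
∣p∣≡sum-indicator []            = refl
∣p∣≡sum-indicator (inside ∷ p)  = cong suc (trans (∣p∣≡sum-indicator p) (sum-indicator-∈∷ inside p))
∣p∣≡sum-indicator (outside ∷ p) = trans (∣p∣≡sum-indicator p) (sum-indicator-∈∷ outside p)

module _ (v : ℕ) .{{_ : NonZero v}} where

  subℤ-+-cancel : ∀ (x y : Fin v) → (subℤ v x y + toℕ y) % v ≡ toℕ x
  subℤ-+-cancel x y = begin
    ((a + (v ∸ b)) % v + b) % v          ≡⟨ cong (λ t → ((a + (v ∸ b)) % v + t) % v) (sym (m<n⇒m%n≡m (toℕ<n y))) ⟩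
    ((a + (v ∸ b)) % v + b % v) % v      ≡⟨ sym (%-distribˡ-+ (a + (v ∸ b)) b v) ⟩
    (a + (v ∸ b) + b) % v                ≡⟨ cong (_% v) (+-assoc a (v ∸ b) b) ⟩
    (a + ((v ∸ b) + b)) % v              ≡⟨ cong (λ t → (a + t) % v) (m∸n+n≡m (<⇒≤ (toℕ<n y))) ⟩
    (a + v) % v                          ≡⟨ [m+n]%n≡m%n a v ⟩
    a % v                                ≡⟨ m<n⇒m%n≡m (toℕ<n x) ⟩
    a                                    ∎
    where
    open ≡-Reasoning
    a = toℕ x
    b = toℕ y

  subℤ≡0⇒≡ : ∀ {x y : Fin v} → subℤ v x y ≡ 0 → x ≡ y
  subℤ≡0⇒≡ {x} {y} x-y≡0 = toℕ-injective (begin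
    toℕ x                   ≡⟨ sym (subℤ-+-cancel x y) ⟩
    (subℤ v x y + toℕ y) % v ≡⟨ cong (λ t → (t + toℕ y) % v) x-y≡0 ⟩
    toℕ y % v               ≡⟨ m<n⇒m%n≡m (toℕ<n y) ⟩
    toℕ y                   ∎)
    where open ≡-Reasoning

module DifferenceCount (v : ℕ) .{{_ : NonZero v}} (D : Subset v) where

  pairs : List (Fin v × Fin v)
  pairs = cartesianProduct (allFin v) (allFin v)

  inD : Fin v → ℕ
  inD x = indicator (x ∈? D)

  distinctPair? : Decidable (λ ((x , y) : Fin v × Fin v) → x ∈ D × y ∈ D × x ≢ y)
  distinctPair? (x , y) = (x ∈? D) ×-dec ((y ∈? D) ×-dec ¬? (x ≟ᶠ y))

  hasDifference? : (g : Fin v) → Decidable (λ ((x , y) : Fin v × Fin v) → x ∈ D × y ∈ D × subℤ v x y ≡ toℕ g)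
  hasDifference? g (x , y) = (x ∈? D) ×-dec ((y ∈? D) ×-dec (subℤ v x y ≟ toℕ g))

  distinctPairs : ℕ
  distinctPairs = sum (map (indicator ∘ distinctPair?) pairs)

  mult≡sum-indicator : ∀ g → mult v D g ≡ sum (map (indicator ∘ hasDifference? g) pairs)
  mult≡sum-indicator g = length-filter≡sum-indicator (hasDifference? g) pairs

  ∣D∣*∣D∣≤distinctPairs+∣D∣ : ∣ D ∣ * ∣ D ∣ ≤ distinctPairs + ∣ D ∣
  ∣D∣*∣D∣≤distinctPairs+∣D∣ = begin
    ∣ D ∣ * ∣ D ∣
      ≡⟨ cong₂ _*_ (∣p∣≡sum-indicator D) (∣p∣≡sum-indicator D) ⟩
    sum (map inD A) * sum (map inD A)
      ≡⟨ sum-map-*-sum-map inD inD A A ⟩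
    sum (map (λ x → sum (map (λ y → inD x * inD y) A)) A)
      ≤⟨ sum-map-mono-≤ (λ x → sum-map-mono-≤ (λ y → split x y) A) A ⟩
    sum (map (λ x → sum (map (λ y → distinct x y + diagonal x y) A)) A)
      ≡⟨ sum-map-cong (λ x → sum-map-+ (distinct x) (diagonal x) A) A ⟩
    sum (map (λ x → sum (map (distinct x) A) + sum (map (diagonal x) A)) A)
      ≡⟨ sum-map-+ _ _ A ⟩
    sum (map (λ x → sum (map (distinct x) A)) A) + sum (map (λ x → sum (map (diagonal x) A)) A)
      ≤⟨ +-mono-≤ (≤-reflexive (sym (sum-map-cartesianProduct (indicator ∘ distinctPair?) A A)))
                  (sum-map-mono-≤ diagonal-row≤inD A) ⟩
    distinctPairs + sum (map inD A)
      ≡⟨ cong (distinctPairs +_) (sym (∣p∣≡sum-indicator D)) ⟩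
    distinctPairs + ∣ D ∣ ∎
    where
    open ≤-Reasoning
    A = allFin v
    distinct diagonal : Fin v → Fin v → ℕ
    distinct x y = indicator (distinctPair? (x , y))
    diagonal x y = inD x * indicator (x ≟ᶠ y)

    split : ∀ x y → inD x * inD y ≤ distinct x y + diagonal x y
    split x y with x ∈? D | y ∈? D | x ≟ᶠ y
    ... | no _  | _     | _     = z≤n
    ... | yes _ | no _  | _     = z≤n
    ... | yes _ | yes _ | yes _ = s≤s z≤n
    ... | yes _ | yes _ | no _  = s≤s z≤n

    diagonal-row≤inD : ∀ x → sum (map (diagonal x) A) ≤ inD x
    diagonal-row≤inD x = begin
      sum (map (diagonal x) A)                          ≡⟨ sum-map-*ˡ (inD x) (λ y → indicator (x ≟ᶠ y)) A ⟩
      inD x * sum (map (λ y → indicator (x ≟ᶠ y)) A)  ≤⟨ *-monoʳ-≤ (inD x) (Unique⇒sum-indicator-≡≤1 x A (allFin⁺ v)) ⟩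
      inD x * 1                                         ≡⟨ *-identityʳ (inD x) ⟩
      inD x                                             ∎

  distinctPair≤sum-hasDifference : ∀ p → indicator (distinctPair? p)
                                   ≤ sum (map (λ g → indicator (hasDifference? g p)) (nonzeroElems v))
  distinctPair≤sum-hasDifference (x , y) = indicator≤ (distinctPair? (x , y)) λ (x∈D , y∈D , x≢y) →
    let open ≤-Reasoning in begin
    1                                         ≡⟨ sym (indicator-yes (x∈D , y∈D , sym (toℕ-fromℕ< x-y<v)) (hasDifference? x-y (x , y))) ⟩
    indicator (hasDifference? x-y (x , y))    ≤⟨ ∈⇒≤sum-map (λ g → indicator (hasDifference? g (x , y))) (x-y∈N x≢y) ⟩
    sum (map (λ g → indicator (hasDifference? g (x , y))) (nonzeroElems v)) ∎
    where
    x-y<v : subℤ v x y < v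
    x-y<v = m%n<n _ v
    x-y : Fin v
    x-y = fromℕ< x-y<v
    x-y∈N : x ≢ y → x-y ∈ˡ nonzeroElems v
    x-y∈N x≢y = ∈-filter⁺ (λ g → ¬? (toℕ g ≟ 0)) (∈-allFin x-y)
                      (λ x-y≡0 → x≢y (subℤ≡0⇒≡ v (trans (sym (toℕ-fromℕ< x-y<v)) x-y≡0)))

  distinctPairs≤sum-mult : distinctPairs ≤ sum (map (mult v D) (nonzeroElems v))
  distinctPairs≤sum-mult = begin
    distinctPairs
      ≤⟨ sum-map-mono-≤ distinctPair≤sum-hasDifference pairs ⟩
    sum (map (λ p → sum (map (λ g → indicator (hasDifference? g p)) (nonzeroElems v))) pairs)
      ≡⟨ sum-map-comm (λ p g → indicator (hasDifference? g p)) pairs (nonzeroElems v) ⟩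
    sum (map (λ g → sum (map (indicator ∘ hasDifference? g) pairs)) (nonzeroElems v))
      ≡⟨ sum-map-cong (λ g → sym (mult≡sum-indicator g)) (nonzeroElems v) ⟩
    sum (map (mult v D) (nonzeroElems v)) ∎
    where open ≤-Reasoning

-- 'allFin (suc n)' starts with 0, which the filter discards by computation.
length-nonzeroElems : ∀ n → length (nonzeroElems (suc n)) ≤ n
length-nonzeroElems n = ≤-trans (length-filter (λ (g : Fin (suc n)) → ¬? (toℕ g ≟ 0)) (tabulate Fin.suc))
                                (≤-reflexive (length-tabulate Fin.suc))

∣D∣*∣D∣≤Lambda*n+∣D∣ : ∀ n (D : Subset (suc n)) → ∣ D ∣ * ∣ D ∣ ≤ Lambda (suc n) D * n + ∣ D ∣
∣D∣*∣D∣≤Lambda*n+∣D∣ n D = begin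
  ∣ D ∣ * ∣ D ∣                                    ≤⟨ ∣D∣*∣D∣≤distinctPairs+∣D∣ ⟩
  distinctPairs + ∣ D ∣                            ≤⟨ +-monoˡ-≤ ∣ D ∣ distinctPairs≤sum-mult ⟩
  sum (map (mult (suc n) D) N) + ∣ D ∣             ≤⟨ +-monoˡ-≤ ∣ D ∣ (sum-map≤length*max (mult (suc n) D) N) ⟩
  length N * Lambda (suc n) D + ∣ D ∣              ≤⟨ +-monoˡ-≤ ∣ D ∣ (*-monoˡ-≤ (Lambda (suc n) D) (length-nonzeroElems n)) ⟩
  n * Lambda (suc n) D + ∣ D ∣                     ≡⟨ cong (_+ ∣ D ∣) (*-comm n (Lambda (suc n) D)) ⟩
  Lambda (suc n) D * n + ∣ D ∣                     ∎
  where
  open ≤-Reasoning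
  open DifferenceCount (suc n) D
  N = nonzeroElems (suc n)

m≤n⇒2*m*n≤m*m+n*n : ∀ {m n} → m ≤ n → 2 * m * n ≤ m * m + n * n
m≤n⇒2*m*n≤m*m+n*n {m} m≤n with t , refl ← m≤n⇒∃[o]m+o≡n m≤n = subst (2 * m * (m + t) ≤_)
  (solve 2 (λ m t → con 2 :* m :* (m :+ t) :+ t :* t := m :* m :+ (m :+ t) :* (m :+ t)) refl m t)
  (m≤m+n (2 * m * (m + t)) (t * t))

2*m*n≤m*m+n*n : ∀ m n → 2 * m * n ≤ m * m + n * n
2*m*n≤m*m+n*n m n with ≤-total m n
... | inj₁ m≤n = m≤n⇒2*m*n≤m*m+n*n m≤n
... | inj₂ n≤m = subst₂ _≤_ (solve 2 (λ m n → con 2 :* n :* m := con 2 :* m :* n) refl m n) (+-comm (n * n) (m * m))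
                             (m≤n⇒2*m*n≤m*m+n*n n≤m)

d*n+k*k≤k*v⇒d*[4*n]≤v*v : ∀ d n k v → d * n + k * k ≤ k * v → d * (4 * n) ≤ v * v
d*n+k*k≤k*v⇒d*[4*n]≤v*v d n k v dn+kk≤kv = +-cancelʳ-≤ (4 * (k * k)) _ _ (begin
  d * (4 * n) + 4 * (k * k)    ≡⟨ solve 3 (λ d n k → d :* (con 4 :* n) :+ con 4 :* (k :* k)
                                                    := con 4 :* (d :* n :+ k :* k)) refl d n k ⟩
  4 * (d * n + k * k)          ≤⟨ *-monoʳ-≤ 4 dn+kk≤kv ⟩
  4 * (k * v)                  ≡⟨ solve 2 (λ k v → con 4 :* (k :* v) := con 2 :* (con 2 :* k) :* v) refl k v ⟩
  2 * (2 * k) * v              ≤⟨ 2*m*n≤m*m+n*n (2 * k) v ⟩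
  2 * k * (2 * k) + v * v      ≡⟨ solve 2 (λ k v → con 2 :* k :* (con 2 :* k) :+ v :* v
                                                := v :* v :+ con 4 :* (k :* k)) refl k v ⟩
  v * v + 4 * (k * k)          ∎)
  where open ≤-Reasoning

k*k≤l*n+k⇒[k∸l]*[4*n]≤[1+n]*[1+n] : ∀ k l n → k * k ≤ l * n + k → (k ∸ l) * (4 * n) ≤ suc n * suc n
k*k≤l*n+k⇒[k∸l]*[4*n]≤[1+n]*[1+n] k l n kk≤ln+k with ≤-total k l
... | inj₁ k≤l rewrite m≤n⇒m∸n≡0 k≤l = z≤n
... | inj₂ l≤k with d , refl ← m≤n⇒∃[o]m+o≡n l≤k rewrite m+n∸m≡n l d =
  d*n+k*k≤k*v⇒d*[4*n]≤v*v d n (l + d) (suc n) (begin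
    d * n + (l + d) * (l + d)      ≤⟨ +-monoʳ-≤ (d * n) kk≤ln+k ⟩
    d * n + (l * n + (l + d))      ≡⟨ solve 3 (λ d l n → d :* n :+ (l :* n :+ (l :+ d)) := (l :+ d) :* (con 1 :+ n)) refl d l n ⟩
    (l + d) * suc n                ∎)
  where open ≤-Reasoning

-- The bound holds for every subset D.
mainTheorem1 : (v k : ℕ) .{{_ : NonZero v}} .{{_ : NonZero (4 * (v ∸ 1))}}
    → 2 ≤ k → k < v → (D : Subset v) → ∣ D ∣ ≡ k
    → periodicDistance v D ≤ (v * v) / (4 * (v ∸ 1))
mainTheorem1 (suc n) _ _ _ D _ =
  subst (_≤ (suc n * suc n) / (4 * n)) (m*n/n≡m (periodicDistance (suc n) D) (4 * n))
    (/-monoˡ-≤ (4 * n) (k*k≤l*n+k⇒[k∸l]*[4*n]≤[1+n]*[1+n] ∣ D ∣ (Lambda (suc n) D) n (∣D∣*∣D∣≤Lambda*n+∣D∣ n D)))
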